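{- Let $\mathbb{F}$ be any field, let $G=([n],E)$ be a directed graph and $\mathcal{S}_G=\langle\mathrm{E}_{i,j}\mid (i,j)\in E\rangle\le\mathrm{M}(n,\mathbb{F})$. The maximum number of arcs in a spanning subgraph of $G$ that is not strongly connected equals the largest dimension of a reducible subspace of $\mathcal{S}_G$.
   Context: Directed graph: $E\subseteq[n]\times[n]$; a spanning subgraph has vertex set $[n]$ and arc set contained in $E$; strongly connected means there is a directed path between every ordered pair of vertices. Vectors in $\mathbb{F}^n$ are row vectors with matrices acting on the right, $B(U)=\{uB\mid u\in U\}$. A matrix space $\mathcal{S}\le\mathrm{M}(n,\mathbb{F})$ is reducible if there is a subspace $0\ne U<\mathbb{F}^n$ with $B(U)\le U$ for all $B\in\mathcal{S}$. $\mathrm{E}_{i,j}$ is the elementary matrix with $1$ at $(i,j)$. -}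

module Defs where

open import Level using (Level; _⊔_; suc)
open import Algebra.Bundles using (CommutativeRing)
open import Data.Nat using (ℕ; zero)
import Data.Nat as ℕ
open import Data.Fin using (Fin; _≟_)
import Data.Fin as F
open import Data.Bool using (Bool; true; false; if_then_else_)
open import Data.Product using (Σ; ∃; _×_; _,_)
open import Relation.Nullary using (¬_; does)
open import Relation.Binary.PropositionalEquality using (_≡_)
open import Relation.Binary.Construct.Closure.ReflexiveTransitive using (Star)

record Field (c ℓ : Level) : Set (suc (c ⊔ ℓ)) where
  field
    commutativeRing : CommutativeRing c ℓ
  open CommutativeRing commutativeRing public
  field
    0≉1     : ¬ (0# ≈ 1#)
    inverse : ∀ x → ¬ (x ≈ 0#) → ∃ λ y → (x * y) ≈ 1#

Graph : ℕ → Set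
Graph n = Fin n → Fin n → Bool

_⊆G_ : ∀ {n} → Graph n → Graph n → Set
H ⊆G G = ∀ i j → H i j ≡ true → G i j ≡ true

sumℕ : ∀ k → (Fin k → ℕ) → ℕ
sumℕ zero    f = 0
sumℕ (ℕ.suc k) f = f F.zero ℕ.+ sumℕ k (λ i → f (F.suc i))

arcs : ∀ {n} → Graph n → ℕ
arcs {n} H = sumℕ n (λ i → sumℕ n (λ j → if H i j then 1 else 0))

Path : ∀ {n} → Graph n → Fin n → Fin n → Set
Path H = Star (λ a b → H a b ≡ true)

StronglyConnected : ∀ {n} → Graph n → Set
StronglyConnected {n} H = ∀ (i j : Fin n) → Path H i j

IsMaxNonSCArcs : ∀ {n} → Graph n → ℕ → Set
IsMaxNonSCArcs {n} G d =
  (∃ λ (H : Graph n) → H ⊆G G × ¬ StronglyConnected H × arcs H ≡ d)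
  × (∀ (H : Graph n) → H ⊆G G → ¬ StronglyConnected H → arcs H ℕ.≤ d)

-- Linear algebra over a field, with row vectors and matrices acting on
-- the right.

module LinAlg {c ℓ} (𝔽 : Field c ℓ) where
  open Field 𝔽

  K : Set c
  K = Carrier

  ∑ : ∀ k → (Fin k → K) → K
  ∑ zero      f = 0#
  ∑ (ℕ.suc k) f = f F.zero + ∑ k (λ i → f (F.suc i))

  Vector : ℕ → Set c
  Vector n = Fin n → K

  Matrix : ℕ → Set c
  Matrix n = Fin n → Fin n → K

  _≈ᵥ_ : ∀ {n} → Vector n → Vector n → Set ℓ
  u ≈ᵥ v = ∀ i → u i ≈ v i

  _≈ₘ_ : ∀ {n} → Matrix n → Matrix n → Set ℓ
  A ≈ₘ B = ∀ i j → A i j ≈ B i j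

  0ᵥ : ∀ {n} → Vector n
  0ᵥ _ = 0#

  0ₘ : ∀ {n} → Matrix n
  0ₘ _ _ = 0#

  _·_ : ∀ {n} → Vector n → Matrix n → Vector n
  _·_ {n} u B j = ∑ n (λ i → u i * B i j)

  Elem : ∀ {n} → Fin n → Fin n → Matrix n
  Elem i j a b = if does (a ≟ i) then (if does (b ≟ j) then 1# else 0#) else 0#

  lincombᵥ : ∀ {n k} → (Fin k → K) → (Fin k → Vector n) → Vector n
  lincombᵥ {k = k} c vs j = ∑ k (λ t → c t * vs t j)

  lincombₘ : ∀ {n k} → (Fin k → K) → (Fin k → Matrix n) → Matrix n
  lincombₘ {k = k} c Ms a b = ∑ k (λ t → c t * Ms t a b)

  _∈Spanᵥ_ : ∀ {n k} → Vector n → (Fin k → Vector n) → Set (c ⊔ ℓ)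
  _∈Spanᵥ_ {k = k} v vs = ∃ λ (coef : Fin k → K) → v ≈ᵥ lincombᵥ coef vs

  _∈Spanₘ_ : ∀ {n k} → Matrix n → (Fin k → Matrix n) → Set (c ⊔ ℓ)
  _∈Spanₘ_ {k = k} A Ms = ∃ λ (coef : Fin k → K) → A ≈ₘ lincombₘ coef Ms

  LinIndepₘ : ∀ {n k} → (Fin k → Matrix n) → Set (c ⊔ ℓ)
  LinIndepₘ {k = k} Ms =
    ∀ (coef : Fin k → K) → lincombₘ coef Ms ≈ₘ 0ₘ → ∀ t → coef t ≈ 0#

  _∈S_ : ∀ {n} → Matrix n → Graph n → Set (c ⊔ ℓ)
  _∈S_ {n} A G = ∃ λ (coef : Fin n → Fin n → K) →
    A ≈ₘ (λ a b → ∑ n (λ i → ∑ n (λ j →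
            (if G i j then coef i j else 0#) * Elem i j a b)))

  -- The matrix space spanned by Bs is reducible: there is a subspace U
  -- (spanned by a finite family us) with 0 ≠ U < 𝔽ⁿ and B(U) ≤ U for all
  -- B in the space.
  Reducible : ∀ {n k} → (Fin k → Matrix n) → Set (c ⊔ ℓ)
  Reducible {n} Bs =
    ∃ λ (m : ℕ) → ∃ λ (us : Fin m → Vector n) →
      (∃ λ v → v ∈Spanᵥ us × ¬ (v ≈ᵥ 0ᵥ))
      × (∃ λ v → ¬ (v ∈Spanᵥ us))
      × (∀ B → B ∈Spanₘ Bs → ∀ u → u ∈Spanᵥ us → (u · B) ∈Spanᵥ us)

  -- there is a reducible subspace of S_G of dimension d
  -- (the subspace is given by a basis Bs of d linearly independent
  -- matrices lying in S_G)
  HasReducibleSubspaceOfDim : ∀ {n} → Graph n → ℕ → Set (c ⊔ ℓ)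
  HasReducibleSubspaceOfDim {n} G d =
    ∃ λ (Bs : Fin d → Matrix n) →
      (∀ t → Bs t ∈S G) × LinIndepₘ Bs × Reducible Bs

  IsMaxReducibleDim : ∀ {n} → Graph n → ℕ → Set (c ⊔ ℓ)
  IsMaxReducibleDim G d =
    HasReducibleSubspaceOfDim G d
    × (∀ e → HasReducibleSubspaceOfDim G e → e ℕ.≤ d)

-- If H ⊆ G is not strongly connected, the vertices reachable from a suitable vertex form a
-- proper nonempty set Q that no arc of H leaves, so H lies inside the graph cut G Q obtained
-- from G by deleting the arcs leaving Q; hence the maximum in question is the largest
-- arcs (cut G Q). On the matrix side, the E_ij with (i,j) an arc of cut G Q span a subspace of
-- S_G of that dimension which leaves the coordinate subspace ⟨e_q | q ∈ Q⟩ invariant.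
-- Conversely, let a subspace of S_G of dimension e leave U invariant and let P be the pivot
-- columns of a reduced echelon basis (w_p) of U; P is proper and nonempty. If B in the subspace
-- vanishes on the positions of cut G P, then for a pivot x the row x of B equals w_x B ∈ U and
-- vanishes on the pivots, so B = 0; a subspace that injects into the coordinates indexed by the
-- arcs of cut G P has dimension at most arcs (cut G P).
-- Equality in 𝔽 is not decidable, so the echelon basis and the dimension bound are obtained
-- under double negation; the conclusions extracted from them are decidable.

module Submission where

open import Defs
open import Level using (Level; _⊔_)
open import Data.Nat as ℕ using (ℕ; zero; suc; _≤_; _<_; _≤?_; z≤n; s≤s)
open import Data.Nat.Properties using (≤-refl; ≤-trans; ≤-antisym; +-mono-≤; +-suc; n<1+n; <-≤-trans)
open import Data.Fin using (Fin; _≟_; splitAt; _↑ˡ_; _↑ʳ_) renaming (zero to fzero; suc to fsuc)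
open import Data.Fin.Properties using (any?; all?; ¬∀⟶∃¬; suc-injective; splitAt⁻¹-↑ˡ; splitAt⁻¹-↑ʳ)
open import Data.Fin.Subset.Properties using (anySubset?)
open import Data.Vec using (lookup; tabulate)
open import Data.Vec.Properties using (lookup∘tabulate)
open import Data.Bool using (Bool; true; false; if_then_else_; _∧_; _∨_; not)
import Data.Bool.Properties as Bool
open import Data.Product using (Σ; ∃; ∃₂; _×_; _,_; proj₁; proj₂)
open import Data.Sum using (_⊎_; inj₁; inj₂)
open import Data.Empty using (⊥)
open import Function using (_∘_; const)
open import Function.Bundles using (_⇔_; mk⇔)
open import Function.Construct.Composition using (_⇔-∘_)
open import Relation.Nullary using (¬_; Dec; yes; no; does; contradiction)
open import Relation.Nullary.Negation using (¬¬-map; negated-stable)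
open import Relation.Nullary.Decidable using (map′; decidable-stable; ¬¬-excluded-middle; _×-dec_)
open import Relation.Binary.PropositionalEquality
  using (_≡_; _≢_; _≗_; refl; sym; trans; cong; cong₂; subst; module ≡-Reasoning)
open import Relation.Binary.Construct.Closure.ReflexiveTransitive using (ε; _◅_; _◅◅_)

private
  variable
    a : Level
    A A′ : Set a
    n : ℕ

-- The library's ¬¬-Monad lives at a single universe level; this bind is level-polymorphic.
_>>=_ : ¬ ¬ A → (A → ¬ ¬ A′) → ¬ ¬ A′
m >>= f = negated-stable (¬¬-map f m)

¬¬-∀Fin : ∀ {P : Fin n → Set a} → (∀ i → ¬ ¬ P i) → ¬ ¬ (∀ i → P i)
¬¬-∀Fin {zero}  f = contradiction λ ()
¬¬-∀Fin {suc n} f = do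
  p₀ ← f fzero
  ps ← ¬¬-∀Fin (f ∘ fsuc)
  contradiction λ where fzero → p₀ ; (fsuc i) → ps i

¬∀⇒¬¬∃¬ : ∀ {P : Fin n → Set a} → ¬ (∀ i → P i) → ¬ ¬ (∃ λ i → ¬ P i)
¬∀⇒¬¬∃¬ ¬∀ ¬∃ = ¬¬-∀Fin (λ i ¬Pi → ¬∃ (i , ¬Pi)) ¬∀

-- Finite sets of vertices as Boolean predicates

sumℕ-cong : ∀ k {f g : Fin k → ℕ} → f ≗ g → sumℕ k f ≡ sumℕ k g
sumℕ-cong zero    f≗g = refl
sumℕ-cong (suc k) f≗g = cong₂ ℕ._+_ (f≗g fzero) (sumℕ-cong k (f≗g ∘ fsuc))

sumℕ-mono : ∀ k {f g : Fin k → ℕ} → (∀ i → f i ≤ g i) → sumℕ k f ≤ sumℕ k g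
sumℕ-mono zero    f≤g = z≤n
sumℕ-mono (suc k) f≤g = +-mono-≤ (f≤g fzero) (sumℕ-mono k (f≤g ∘ fsuc))

sumℕ-suc-at : ∀ k {f g : Fin k → ℕ} (q : Fin k) → f q ≡ suc (g q) →
              (∀ i → i ≢ q → f i ≡ g i) → sumℕ k f ≡ suc (sumℕ k g)
sumℕ-suc-at (suc k) fzero    fq f≡g =
  cong₂ ℕ._+_ fq (sumℕ-cong k (λ i → f≡g (fsuc i) λ ()))
sumℕ-suc-at (suc k) {g = g} (fsuc q) fq f≡g =
  trans (cong₂ ℕ._+_ (f≡g fzero λ ()) (sumℕ-suc-at k q fq λ i i≢q → f≡g (fsuc i) (i≢q ∘ suc-injective)))
        (+-suc (g fzero) _)

count : (Fin n → Bool) → ℕ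
count {n} P = sumℕ n (λ i → if P i then 1 else 0)

count-drop : ∀ {P P′ : Fin n → Bool} q → P q ≡ true → P′ q ≡ false →
             (∀ i → i ≢ q → P i ≡ P′ i) → count P ≡ suc (count P′)
count-drop {n} q Pq P′q P≡P′ =
  sumℕ-suc-at n q (one-to-zero Pq P′q) (λ i i≢q → cong (λ b → if b then 1 else 0) (P≡P′ i i≢q))
  where
  one-to-zero : ∀ {b b′} → b ≡ true → b′ ≡ false → (if b then 1 else 0) ≡ suc (if b′ then 1 else 0)
  one-to-zero refl refl = refl

count-mono : ∀ {P P′ : Fin n → Bool} → (∀ i → P i ≡ true → P′ i ≡ true) → count P ≤ count P′
count-mono {n} P⊆P′ = sumℕ-mono n λ i → indicator-mono (P⊆P′ i)
  where
  indicator-mono : ∀ {b b′} → (b ≡ true → b′ ≡ true) → (if b then 1 else 0) ≤ (if b′ then 1 else 0)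
  indicator-mono {false}         _    = z≤n
  indicator-mono {true}  {true}  _    = ≤-refl
  indicator-mono {true}  {false} b⇒b′ = contradiction (b⇒b′ refl) λ ()

insert : Fin n → (Fin n → Bool) → (Fin n → Bool)
insert q R i = does (i ≟ q) ∨ R i

insert-≢ : ∀ {q i} (R : Fin n → Bool) → i ≢ q → insert q R i ≡ R i
insert-≢ {q = q} {i} R i≢q with i ≟ q
... | yes i≡q = contradiction i≡q i≢q
... | no  _   = refl

insert-self : ∀ q (R : Fin n → Bool) → insert q R q ≡ true
insert-self q R with q ≟ q
... | yes _   = refl
... | no  q≢q = contradiction refl q≢q

insert-⊇ : ∀ q (R : Fin n → Bool) i → R i ≡ true → insert q R i ≡ true
insert-⊇ q R i Ri with does (i ≟ q)
... | true  = refl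
... | false = Ri

insert-elim : ∀ {q i} (R : Fin n → Bool) → insert q R i ≡ true → i ≡ q ⊎ R i ≡ true
insert-elim {q = q} {i} R h with i ≟ q
... | yes i≡q = inj₁ i≡q
... | no  _   = inj₂ h

missing : (Fin n → Bool) → ℕ
missing R = count (not ∘ R)

missing-insert : ∀ (R : Fin n → Bool) q → R q ≡ false → missing (insert q R) < missing R
missing-insert R q Rq rewrite count-drop {P = not ∘ R} {P′ = not ∘ insert q R} q
  (cong not Rq) (cong not (insert-self q R)) (λ i i≢q → cong not (sym (insert-≢ R i≢q)))
  = n<1+n _

-- Induction on the number of elements outside R, in continuation-passing form: each step
-- either reaches the goal or continues from a strictly larger set.
saturate : ∀ {p q} (Inv : (Fin n → Bool) → Set p) {Goal : Set q} →
           (∀ R → Inv R → (∀ r → R r ≡ false → Inv (insert r R) → Goal) → Goal) →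
           ∀ R → Inv R → Goal
saturate Inv {Goal} step R = go (suc (missing R)) R (n<1+n _)
  where
  go : ∀ N R → missing R < N → Inv R → Goal
  go (suc N) R (s≤s missing≤N) inv =
    step R inv λ r Rr → go N (insert r R) (<-≤-trans (missing-insert R r Rr) missing≤N)

any-subset? : {A : (Fin n → Bool) → Set a} → (∀ P → Dec (A P)) →
              (∀ {P P′} → P ≗ P′ → A P → A P′) → Dec (∃ A)
any-subset? A? resp = map′ (λ (S , AS) → lookup S , AS)
  (λ (P , AP) → tabulate P , resp (sym ∘ lookup∘tabulate P) AP)
  (anySubset? (A? ∘ lookup))

-- Graphs

Proper : (Fin n → Bool) → Set
Proper Q = (∃ λ i → Q i ≡ true) × (∃ λ j → Q j ≡ false)

Proper? : (Q : Fin n → Bool) → Dec (Proper Q)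
Proper? Q = any? (λ i → Q i Bool.≟ true) ×-dec any? (λ j → Q j Bool.≟ false)

Closed : Graph n → (Fin n → Bool) → Set
Closed H Q = ∀ i j → Q i ≡ true → Q j ≡ false → H i j ≡ false

cut : Graph n → (Fin n → Bool) → Graph n
cut G Q i j = G i j ∧ not (Q i ∧ not (Q j))

module _ {H : Graph n} {Q : Fin n → Bool} (closed : Closed H Q) where

  path-stays : ∀ {i j} → Path H i j → Q i ≡ true → Q j ≡ true
  path-stays ε                   Qi = Qi
  path-stays (_◅_ {j = k} Hik p) Qi with Q k in Qk
  ... | true  = path-stays p Qk
  ... | false = contradiction (trans (sym Hik) (closed _ k Qi Qk)) λ ()

  closed⇒¬SC : Proper Q → ¬ StronglyConnected H
  closed⇒¬SC ((i , Qi) , (j , Qj)) sc = contradiction (trans (sym (path-stays (sc i j) Qi)) Qj) λ ()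

cut-⊆ : ∀ (G : Graph n) Q → cut G Q ⊆G G
cut-⊆ G Q i j = Bool.∧-conicalˡ (G i j) _

cut-closed : ∀ (G : Graph n) Q → Closed (cut G Q) Q
cut-closed G Q i j Qi Qj rewrite Qi | Qj = Bool.∧-zeroʳ (G i j)

cut-keeps : ∀ (G : Graph n) Q {i j} → G i j ≡ true → Q i ≡ false ⊎ Q j ≡ true → cut G Q i j ≡ true
cut-keeps G Q {i} {j} Gij not-leaving rewrite Gij with Q i | Q j | not-leaving
... | false | _     | _ = refl
... | true  | true  | _ = refl
... | true  | false | inj₁ ()
... | true  | false | inj₂ ()

closed-⊆cut : ∀ {H G : Graph n} {Q} → H ⊆G G → Closed H Q → H ⊆G cut G Q
closed-⊆cut {H = H} {Q = Q} H⊆G closed i j Hij rewrite H⊆G i j Hij with Q i in Qi | Q j in Qj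
... | false | _     = refl
... | true  | true  = refl
... | true  | false = contradiction (trans (sym Hij) (closed i j Qi Qj)) λ ()

cut-¬SC : ∀ (G : Graph n) {Q} → Proper Q → ¬ StronglyConnected (cut G Q)
cut-¬SC G {Q} = closed⇒¬SC (cut-closed G Q)

arcs-mono : ∀ {H H′ : Graph n} → H ⊆G H′ → arcs H ≤ arcs H′
arcs-mono {n} H⊆H′ = sumℕ-mono n λ i → count-mono (H⊆H′ i)

arcs-cong : ∀ {H H′ : Graph n} → (∀ i j → H i j ≡ H′ i j) → arcs H ≡ arcs H′
arcs-cong {n} H≡H′ = sumℕ-cong n λ i → sumℕ-cong n λ j → cong (λ b → if b then 1 else 0) (H≡H′ i j)

deleteArc : Graph n → Fin n → Fin n → Graph n
deleteArc M a b i j = M i j ∧ not (does (i ≟ a) ∧ does (j ≟ b))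

deleteArc-≢ : ∀ (M : Graph n) {a b i j} → ¬ (i ≡ a × j ≡ b) → deleteArc M a b i j ≡ M i j
deleteArc-≢ M {a} {b} {i} {j} ≢ab with i ≟ a | j ≟ b
... | yes i≡a | yes j≡b = contradiction (i≡a , j≡b) ≢ab
... | yes _   | no  _   = Bool.∧-identityʳ (M i j)
... | no  _   | _       = Bool.∧-identityʳ (M i j)

arcs-deleteArc : ∀ (M : Graph n) {a b} → M a b ≡ true → arcs M ≡ suc (arcs (deleteArc M a b))
arcs-deleteArc {n} M {a} {b} Mab = sumℕ-suc-at n a
  (count-drop b Mab deleted (λ j j≢b → sym (deleteArc-≢ M (j≢b ∘ proj₂))))
  (λ i i≢a → sumℕ-cong n λ j → cong (λ b → if b then 1 else 0) (sym (deleteArc-≢ M (i≢a ∘ proj₁))))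
  where
  deleted : deleteArc M a b a b ≡ false
  deleted with a ≟ a | b ≟ b
  ... | yes _ | yes _ = Bool.∧-zeroʳ (M a b)
  ... | no a≢a | _    = contradiction refl a≢a
  ... | yes _ | no b≢b = contradiction refl b≢b

module _ (H : Graph n) where

  record ReachableClosure (i : Fin n) : Set where
    field
      members   : Fin n → Bool
      source    : members i ≡ true
      reachable : ∀ j → members j ≡ true → Path H i j
      closed    : Closed H members

  reachable-closure : ∀ i → ReachableClosure i
  reachable-closure i = saturate Reached step singleton (insert-self i _ , start)
    where
    Reached : (Fin n → Bool) → Set
    Reached R = R i ≡ true × (∀ j → R j ≡ true → Path H i j)

    singleton : Fin n → Bool
    singleton = insert i (λ _ → false)

    start : ∀ j → singleton j ≡ true → Path H i j
    start j h with insert-elim {q = i} {j} _ h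
    ... | inj₁ refl = ε

    leaving? : ∀ R → Dec (∃₂ λ a b → R a ≡ true × R b ≡ false × H a b ≡ true)
    leaving? R = any? λ a → any? λ b → R a Bool.≟ true ×-dec R b Bool.≟ false ×-dec H a b Bool.≟ true

    step : ∀ R → Reached R → (∀ r → R r ≡ false → Reached (insert r R) → ReachableClosure i) →
           ReachableClosure i
    step R (Ri , reach) extend with leaving? R
    ... | no ¬leaving = record
      { members = R ; source = Ri ; reachable = reach
      ; closed = λ a b Ra Rb → Bool.¬-not λ Hab → ¬leaving (a , b , Ra , Rb , Hab) }
    ... | yes (a , b , Ra , Rb , Hab) = extend b Rb (insert-⊇ b R i Ri , reach′)
      where
      reach′ : ∀ j → insert b R j ≡ true → Path H i j
      reach′ j h with insert-elim R h
      ... | inj₁ refl = reach a Ra ◅◅ (Hab ◅ ε)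
      ... | inj₂ Rj   = reach j Rj

  reached : Fin n → Fin n → Bool
  reached i = ReachableClosure.members (reachable-closure i)

  all-reached⇒SC : (∀ i j → reached i j ≡ true) → StronglyConnected H
  all-reached⇒SC all i j = ReachableClosure.reachable (reachable-closure i) j (all i j)

  ¬SC⇒closed : ¬ StronglyConnected H → ∃ λ Q → Proper Q × Closed H Q
  ¬SC⇒closed ¬sc with ¬∀⟶∃¬ n _ (λ i → all? λ j → reached i j Bool.≟ true) (¬sc ∘ all-reached⇒SC)
  ... | i , ¬all with ¬∀⟶∃¬ n _ (λ j → reached i j Bool.≟ true) ¬all
  ...   | j , ¬Rj = reached i , ((i , source) , (j , Bool.¬-not ¬Rj)) , closed
    where open ReachableClosure (reachable-closure i)

IsMaxCut : Graph n → ℕ → Set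
IsMaxCut {n} G d =
  (∃ λ (Q : Fin n → Bool) → Proper Q × arcs (cut G Q) ≡ d) × (∀ Q → Proper Q → arcs (cut G Q) ≤ d)

isMaxNonSCArcs⇔isMaxCut : ∀ (G : Graph n) d → IsMaxNonSCArcs G d ⇔ IsMaxCut G d
isMaxNonSCArcs⇔isMaxCut G d = mk⇔ to from
  where
  to : IsMaxNonSCArcs G d → IsMaxCut G d
  to ((H , H⊆G , ¬sc , arcsH≡d) , max) = attained (¬SC⇒closed H ¬sc) , cut-max
    where
    cut-max : ∀ Q → Proper Q → arcs (cut G Q) ≤ d
    cut-max Q proper = max (cut G Q) (cut-⊆ G Q) (cut-¬SC G proper)

    attained : (∃ λ Q → Proper Q × Closed H Q) → ∃ λ Q → Proper Q × arcs (cut G Q) ≡ d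
    attained (Q , proper , closed) = Q , proper , ≤-antisym (cut-max Q proper)
      (subst (_≤ arcs (cut G Q)) arcsH≡d (arcs-mono (closed-⊆cut H⊆G closed)))

  from : IsMaxCut G d → IsMaxNonSCArcs G d
  from ((Q , proper , arcs≡d) , max) = (cut G Q , cut-⊆ G Q , cut-¬SC G proper , arcs≡d) , nonSC-max
    where
    nonSC-max : ∀ H → H ⊆G G → ¬ StronglyConnected H → arcs H ≤ d
    nonSC-max H H⊆G ¬sc = bound (¬SC⇒closed H ¬sc)
      where
      bound : (∃ λ Q → Proper Q × Closed H Q) → arcs H ≤ d
      bound (Q′ , proper′ , closed′) = ≤-trans (arcs-mono (closed-⊆cut H⊆G closed′)) (max Q′ proper′)

large-cut? : ∀ (G : Graph n) d → Dec (∃ λ Q → Proper Q × d ≤ arcs (cut G Q))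
large-cut? G d = any-subset? (λ Q → Proper? Q ×-dec d ≤? arcs (cut G Q)) resp
  where
  resp : ∀ {Q Q′} → Q ≗ Q′ → Proper Q × d ≤ arcs (cut G Q) → Proper Q′ × d ≤ arcs (cut G Q′)
  resp Q≗Q′ (((i , Qi) , (j , Qj)) , d≤) =
    ((i , trans (sym (Q≗Q′ i)) Qi) , (j , trans (sym (Q≗Q′ j)) Qj)) ,
    subst (d ≤_) (arcs-cong λ x y → cong₂ (λ p q → G x y ∧ not (p ∧ not q)) (Q≗Q′ x) (Q≗Q′ y)) d≤

unflatten : ∀ k (c : Fin k → ℕ) → Fin (sumℕ k c) → Σ (Fin k) (Fin ∘ c)
unflatten (suc k) c t with splitAt (c fzero) t
... | inj₁ r = fzero , r
... | inj₂ t′ with unflatten k (c ∘ fsuc) t′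
...   | i , r = fsuc i , r

flatten : ∀ k (c : Fin k → ℕ) → Σ (Fin k) (Fin ∘ c) → Fin (sumℕ k c)
flatten (suc k) c (fzero  , r) = r ↑ˡ _
flatten (suc k) c (fsuc i , r) = c fzero ↑ʳ flatten k (c ∘ fsuc) (i , r)

flatten∘unflatten : ∀ k c t → flatten k c (unflatten k c t) ≡ t
flatten∘unflatten (suc k) c t with splitAt (c fzero) t in eq
... | inj₁ r  = splitAt⁻¹-↑ˡ eq
... | inj₂ t′ = trans (cong (c fzero ↑ʳ_) (flatten∘unflatten k (c ∘ fsuc) t′)) (splitAt⁻¹-↑ʳ eq)

-- arcs M = Σᵢ Σⱼ [M i j], so Fin (arcs M) enumerates the arcs of M.
module _ (M : Graph n) where

  ArcIndex : Set
  ArcIndex = Σ (Fin n) λ i → Σ (Fin n) λ j → Fin (if M i j then 1 else 0)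

  decodeArc : Fin (arcs M) → ArcIndex
  decodeArc t with unflatten n (count ∘ M) t
  ... | i , r = i , unflatten n (λ j → if M i j then 1 else 0) r

  encodeArc : ArcIndex → Fin (arcs M)
  encodeArc (i , j , x) = flatten n (count ∘ M) (i , flatten n (λ j → if M i j then 1 else 0) (j , x))

  encode∘decode : ∀ t → encodeArc (decodeArc t) ≡ t
  encode∘decode t with unflatten n (count ∘ M) t in eq
  ... | i , r = begin
    flatten n (count ∘ M) (i , flatten n _ (unflatten n _ r))
      ≡⟨ cong (λ r′ → flatten n _ (i , r′)) (flatten∘unflatten n _ r) ⟩
    flatten n (count ∘ M) (i , r)                             ≡⟨ cong (flatten n _) eq ⟨
    flatten n (count ∘ M) (unflatten n _ t)                   ≡⟨ flatten∘unflatten n _ t ⟩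
    t                                                         ∎
    where open ≡-Reasoning

  source target : Fin (arcs M) → Fin n
  source = proj₁ ∘ decodeArc
  target = proj₁ ∘ proj₂ ∘ decodeArc

  arc-∈ : ∀ t → M (source t) (target t) ≡ true
  arc-∈ t = indicator-true (proj₂ (proj₂ (decodeArc t)))
    where
    indicator-true : ∀ {b} → Fin (if b then 1 else 0) → b ≡ true
    indicator-true {true} _ = refl

  arc-injective : ∀ {t t′} → source t ≡ source t′ → target t ≡ target t′ → t ≡ t′
  arc-injective {t} {t′} eq₁ eq₂ = begin
    t                        ≡⟨ encode∘decode t ⟨
    encodeArc (decodeArc t)  ≡⟨ cong encodeArc (ArcIndex-≡ (decodeArc t) (decodeArc t′) eq₁ eq₂) ⟩
    encodeArc (decodeArc t′) ≡⟨ encode∘decode t′ ⟩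
    t′                       ∎
    where
    open ≡-Reasoning
    ArcIndex-≡ : ∀ (x y : ArcIndex) → proj₁ x ≡ proj₁ y → proj₁ (proj₂ x) ≡ proj₁ (proj₂ y) → x ≡ y
    ArcIndex-≡ (i , j , x) (i , j , y) refl refl = cong (λ z → i , j , z) (indicator-unique x y)
      where
      indicator-unique : ∀ {b} (x y : Fin (if b then 1 else 0)) → x ≡ y
      indicator-unique {true} fzero fzero = refl

-- Linear algebra over a field

module _ {c ℓ} (𝔽 : Field c ℓ) where

  open Field 𝔽 renaming (refl to ≈-refl; sym to ≈-sym; trans to ≈-trans)
  open LinAlg 𝔽
  open import Algebra.Properties.Ring ring using (-0#≈0#; -‿distribˡ-*)
  open import Algebra.Properties.CommutativeSemigroup +-commutativeSemigroup using (interchange)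
  open import Relation.Binary.Reasoning.Setoid setoid

  -- Defs' ∑ is not definitionally the library's sum at variable length, so its laws are proved here.
  ∑-cong : ∀ k {f g : Fin k → K} → (∀ i → f i ≈ g i) → ∑ k f ≈ ∑ k g
  ∑-cong zero    f≈g = ≈-refl
  ∑-cong (suc k) f≈g = +-cong (f≈g fzero) (∑-cong k (f≈g ∘ fsuc))

  ∑-zero : ∀ k {f : Fin k → K} → (∀ i → f i ≈ 0#) → ∑ k f ≈ 0#
  ∑-zero zero    f≈0 = ≈-refl
  ∑-zero (suc k) f≈0 = ≈-trans (+-cong (f≈0 fzero) (∑-zero k (f≈0 ∘ fsuc))) (+-identityˡ 0#)

  ∑-distrib-+ : ∀ k (f g : Fin k → K) → ∑ k (λ i → f i + g i) ≈ ∑ k f + ∑ k g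
  ∑-distrib-+ zero    f g = ≈-sym (+-identityˡ 0#)
  ∑-distrib-+ (suc k) f g = begin
    (f fzero + g fzero) + ∑ k (λ i → f (fsuc i) + g (fsuc i))  ≈⟨ +-congˡ (∑-distrib-+ k (f ∘ fsuc) (g ∘ fsuc)) ⟩
    (f fzero + g fzero) + (∑ k (f ∘ fsuc) + ∑ k (g ∘ fsuc))    ≈⟨ interchange _ _ _ _ ⟩
    (f fzero + ∑ k (f ∘ fsuc)) + (g fzero + ∑ k (g ∘ fsuc))    ∎

  *-distribˡ-∑ : ∀ k x (f : Fin k → K) → x * ∑ k f ≈ ∑ k (λ i → x * f i)
  *-distribˡ-∑ zero    x f = zeroʳ x
  *-distribˡ-∑ (suc k) x f = ≈-trans (distribˡ x _ _) (+-congˡ (*-distribˡ-∑ k x (f ∘ fsuc)))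

  *-distribʳ-∑ : ∀ k x (f : Fin k → K) → ∑ k f * x ≈ ∑ k (λ i → f i * x)
  *-distribʳ-∑ zero    x f = zeroˡ x
  *-distribʳ-∑ (suc k) x f = ≈-trans (distribʳ x _ _) (+-congˡ (*-distribʳ-∑ k x (f ∘ fsuc)))

  ∑-δ : ∀ k (f : Fin k → K) i → (∀ j → j ≢ i → f j ≈ 0#) → ∑ k f ≈ f i
  ∑-δ (suc k) f fzero    f≈0 = ≈-trans (+-congˡ (∑-zero k λ j → f≈0 (fsuc j) λ ())) (+-identityʳ _)
  ∑-δ (suc k) f (fsuc i) f≈0 =
    ≈-trans (+-cong (f≈0 fzero λ ()) (∑-δ k (f ∘ fsuc) i λ j j≢i → f≈0 (fsuc j) (j≢i ∘ suc-injective)))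
            (+-identityˡ _)

  VanishesOn : (Fin n → Bool) → Vector n → Set ℓ
  VanishesOn P u = ∀ p → P p ≡ true → u p ≈ 0#

  sub-vanishing : ∀ {x y} t → y ≈ 0# → x - t * y ≈ x
  sub-vanishing {x} {y} t y≈0 = begin
    x - t * y ≈⟨ +-congˡ (-‿cong (≈-trans (*-congˡ y≈0) (zeroʳ t))) ⟩
    x - 0#    ≈⟨ +-congˡ -0#≈0# ⟩
    x + 0#    ≈⟨ +-identityʳ x ⟩
    x         ∎

  module _ {m} (us : Fin m → Vector n) where

    ∈Span-cong : ∀ {u v} → u ≈ᵥ v → u ∈Spanᵥ us → v ∈Spanᵥ us
    ∈Span-cong u≈v (coef , u≈) = coef , λ j → ≈-trans (≈-sym (u≈v j)) (u≈ j)

    0∈Span : 0ᵥ ∈Spanᵥ us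
    0∈Span = (λ _ → 0#) , λ j → ≈-sym (∑-zero m λ t → zeroˡ _)

    ∈Span-axpy : ∀ x {u v} → u ∈Spanᵥ us → v ∈Spanᵥ us → (λ j → x * u j + v j) ∈Spanᵥ us
    ∈Span-axpy x {u} {v} (cu , u≈) (cv , v≈) = (λ t → x * cu t + cv t) , λ j → begin
      x * u j + v j
        ≈⟨ +-cong (*-congˡ (u≈ j)) (v≈ j) ⟩
      x * ∑ m (λ t → cu t * us t j) + ∑ m (λ t → cv t * us t j)
        ≈⟨ +-congʳ (*-distribˡ-∑ m x _) ⟩
      ∑ m (λ t → x * (cu t * us t j)) + ∑ m (λ t → cv t * us t j)
        ≈⟨ ∑-distrib-+ m _ _ ⟨
      ∑ m (λ t → x * (cu t * us t j) + cv t * us t j)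
        ≈⟨ ∑-cong m (λ t → ≈-trans (distribʳ _ _ _) (+-congʳ (*-assoc _ _ _))) ⟨
      ∑ m (λ t → (x * cu t + cv t) * us t j)
        ∎

    ∈Span-scale : ∀ x {u} → u ∈Spanᵥ us → (λ j → x * u j) ∈Spanᵥ us
    ∈Span-scale x u∈ = ∈Span-cong (λ j → +-identityʳ _) (∈Span-axpy x u∈ 0∈Span)

    ∈Span-sub : ∀ x {u v} → u ∈Spanᵥ us → v ∈Spanᵥ us → (λ j → u j - x * v j) ∈Spanᵥ us
    ∈Span-sub x u∈ v∈ = ∈Span-cong (λ j → ≈-trans (+-congʳ (≈-sym (-‿distribˡ-* x _))) (+-comm _ _))
                                   (∈Span-axpy (- x) v∈ u∈)

    ∈Span-lincomb : ∀ {k} (coef : Fin k → K) {vs : Fin k → Vector n} →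
                    (∀ t → vs t ∈Spanᵥ us) → lincombᵥ coef vs ∈Spanᵥ us
    ∈Span-lincomb {zero}  coef vs∈ = 0∈Span
    ∈Span-lincomb {suc k} coef vs∈ = ∈Span-axpy (coef fzero) (vs∈ fzero) (∈Span-lincomb (coef ∘ fsuc) (vs∈ ∘ fsuc))

    -- Rows of a reduced echelon form of U = span us with pivot columns P; Complete P says that they span U.
    record EchelonBasis (P : Fin n → Bool) : Set (c ⊔ ℓ) where
      field
        vec      : Fin n → Vector n
        vec∈U    : ∀ i → P i ≡ true → vec i ∈Spanᵥ us
        vec-diag : ∀ i → P i ≡ true → vec i i ≈ 1#
        vec-off  : ∀ i k → P i ≡ true → P k ≡ true → k ≢ i → vec i k ≈ 0#

    Complete : (Fin n → Bool) → Set (c ⊔ ℓ)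
    Complete P = ∀ u → u ∈Spanᵥ us → VanishesOn P u → ¬ ¬ (u ≈ᵥ 0ᵥ)

    extend : ∀ {P} → EchelonBasis P → ∀ {u} → u ∈Spanᵥ us → VanishesOn P u →
             ∀ {q z} → u q * z ≈ 1# → EchelonBasis (insert q P)
    extend {P} basis {u} u∈U u|P {q} {z} uq*z≈1 = record
      { vec = vec′ ; vec∈U = vec∈U′ ; vec-diag = vec-diag′ ; vec-off = vec-off′ }
      where
      open EchelonBasis basis
      new : Vector n
      new j = z * u j

      new|P : VanishesOn P new
      new|P k Pk = ≈-trans (*-congˡ (u|P k Pk)) (zeroʳ z)

      new-q : new q ≈ 1#
      new-q = ≈-trans (*-comm z (u q)) uq*z≈1

      vec′ : Fin n → Vector n
      vec′ i = if does (i ≟ q) then new else λ j → vec i j - vec i q * new j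

      vec∈U′ : ∀ i → insert q P i ≡ true → vec′ i ∈Spanᵥ us
      vec∈U′ i Pi with i ≟ q
      ... | yes _ = ∈Span-scale z u∈U
      ... | no  _ = ∈Span-sub (vec i q) (vec∈U i Pi) (∈Span-scale z u∈U)

      vec-diag′ : ∀ i → insert q P i ≡ true → vec′ i i ≈ 1#
      vec-diag′ i Pi with i ≟ q
      ... | yes refl = new-q
      ... | no  _    = ≈-trans (sub-vanishing (vec i q) (new|P i Pi)) (vec-diag i Pi)

      vec-off′ : ∀ i k → insert q P i ≡ true → insert q P k ≡ true → k ≢ i → vec′ i k ≈ 0#
      vec-off′ i k Pi Pk k≢i with i ≟ q | k ≟ q
      ... | yes refl | yes refl = contradiction refl k≢i
      ... | yes refl | no  _    = new|P k Pk
      ... | no  _    | yes refl = begin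
        vec i q - vec i q * new q ≈⟨ +-congˡ (-‿cong (≈-trans (*-congˡ new-q) (*-identityʳ _))) ⟩
        vec i q - vec i q         ≈⟨ -‿inverseʳ _ ⟩
        0#                        ∎
      ... | no  _    | no  _    = ≈-trans (sub-vanishing (vec i q) (new|P k Pk)) (vec-off i k Pi Pk k≢i)

    echelon-basis : ¬ ¬ (∃ λ P → EchelonBasis P × Complete P)
    echelon-basis no-basis = saturate EchelonBasis step (λ _ → false) empty
      where
      empty : EchelonBasis (λ _ → false)
      empty = record { vec = λ _ → 0ᵥ ; vec∈U = λ _ () ; vec-diag = λ _ () ; vec-off = λ _ _ () }

      step : ∀ P → EchelonBasis P → (∀ r → P r ≡ false → EchelonBasis (insert r P) → ⊥) → ⊥
      step P basis extend-at = ¬¬-excluded-middle λ where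
        (yes complete)  → no-basis (P , basis , complete)
        (no incomplete) → incomplete λ u u∈U u|P u≉0 → ¬∀⇒¬¬∃¬ u≉0 λ (q , uq≉0) →
          extend-at q (Bool.¬-not (uq≉0 ∘ u|P q)) (extend basis u∈U u|P (proj₂ (inverse (u q) uq≉0)))

    module _ {P} (basis : EchelonBasis P) (complete : Complete P) where
      open EchelonBasis basis

      pivot-exists : ∀ {v} → v ∈Spanᵥ us → ¬ (v ≈ᵥ 0ᵥ) → ¬ ¬ (∃ λ i → P i ≡ true)
      pivot-exists {v} v∈U v≉0 none = complete v v∈U (λ p Pp → contradiction (p , Pp) none) v≉0

      non-pivot-exists : ∀ {v} → ¬ (v ∈Spanᵥ us) → ¬ ¬ (∃ λ j → P j ≡ false)
      non-pivot-exists {v} v∉U none = v∉U (∈Span-cong expand (∈Span-lincomb v λ i → vec∈U i (pivot i)))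
        where
        pivot : ∀ j → P j ≡ true
        pivot j = Bool.¬-not λ Pj → none (j , Pj)
        expand : lincombᵥ v vec ≈ᵥ v
        expand j = ≈-trans (∑-δ n _ j λ i i≢j →
                             ≈-trans (*-congˡ (vec-off i j (pivot i) (pivot j) (i≢j ∘ sym))) (zeroʳ _))
                           (≈-trans (*-congˡ (vec-diag j (pivot j))) (*-identityʳ _))

      invariant-leaving⇒zero : ∀ {B} → (∀ u → u ∈Spanᵥ us → (u · B) ∈Spanᵥ us) →
                               (∀ k z → P k ≡ false ⊎ P z ≡ true → B k z ≈ 0#) → ¬ ¬ (B ≈ₘ 0ₘ)
      invariant-leaving⇒zero {B} invariant supported = ¬¬-∀Fin λ x → ¬¬-∀Fin λ y → entry x y
        where
        entry : ∀ x y → ¬ ¬ (B x y ≈ 0#)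
        entry x y with P x in Px | P y in Py
        ... | false | _     = contradiction (supported x y (inj₁ Px))
        ... | true  | true  = contradiction (supported x y (inj₂ Py))
        -- row x of B is (vec x)·B ∈ U, which vanishes on the pivots
        ... | true  | false = ¬¬-map (λ row≈0 → ≈-trans (≈-sym (row y)) (row≈0 y))
                                     (complete (vec x · B) (invariant (vec x) (vec∈U x Px)) row|P)
          where
          row : ∀ z → (vec x · B) z ≈ B x z
          row z = ≈-trans (∑-δ n _ x term) (≈-trans (*-congʳ (vec-diag x Px)) (*-identityˡ _))
            where
            term : ∀ k → k ≢ x → vec x k * B k z ≈ 0#
            term k k≢x with P k in Pk
            ... | false = ≈-trans (*-congˡ (supported k z (inj₁ Pk))) (zeroʳ _)
            ... | true  = ≈-trans (*-congʳ (vec-off x k Px Pk k≢x)) (zeroˡ _)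
          row|P : VanishesOn P (vec x · B)
          row|P p Pp = ≈-trans (row p) (supported x p (inj₂ Pp))

  Elem-diag : ∀ (a b : Fin n) → Elem a b a b ≈ 1#
  Elem-diag a b with a ≟ a | b ≟ b
  ... | yes _  | yes _  = ≈-refl
  ... | no a≢a | _      = contradiction refl a≢a
  ... | yes _  | no b≢b = contradiction refl b≢b

  Elem-off : ∀ (a b x y : Fin n) → ¬ (x ≡ a × y ≡ b) → Elem a b x y ≈ 0#
  Elem-off a b x y ≢ab with x ≟ a | y ≟ b
  ... | yes x≡a | yes y≡b = contradiction (x≡a , y≡b) ≢ab
  ... | yes _   | no  _   = ≈-refl
  ... | no  _   | _       = ≈-refl

  ∑∑-Elem : ∀ (X : Matrix n) x y → ∑ n (λ i → ∑ n (λ j → X i j * Elem i j x y)) ≈ X x y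
  ∑∑-Elem {n} X x y = begin
    ∑ n (λ i → ∑ n (λ j → X i j * Elem i j x y))
      ≈⟨ ∑-δ n _ x (λ i i≢x → ∑-zero n λ j → off (i≢x ∘ sym ∘ proj₁)) ⟩
    ∑ n (λ j → X x j * Elem x j x y)             ≈⟨ ∑-δ n _ y (λ j j≢y → off (j≢y ∘ sym ∘ proj₂)) ⟩
    X x y * Elem x y x y                         ≈⟨ *-congˡ (Elem-diag x y) ⟩
    X x y * 1#                                   ≈⟨ *-identityʳ _ ⟩
    X x y                                        ∎
    where
    off : ∀ {i j} → ¬ (x ≡ i × y ≡ j) → X i j * Elem i j x y ≈ 0#
    off {i} {j} ≢ij = ≈-trans (*-congˡ (Elem-off i j x y ≢ij)) (zeroʳ _)

  ∈S-support : ∀ {G : Graph n} {A} → A ∈S G → ∀ {x y} → G x y ≡ false → A x y ≈ 0#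
  ∈S-support {G = G} (coef , A≈) {x} {y} Gxy = ≈-trans (A≈ x y) (≈-trans (∑∑-Elem _ x y) (unselected Gxy))
    where
    unselected : G x y ≡ false → (if G x y then coef x y else 0#) ≈ 0#
    unselected Gxy rewrite Gxy = ≈-refl

  Elem∈S : ∀ {G : Graph n} {a b} → G a b ≡ true → Elem a b ∈S G
  Elem∈S {G = G} {a} {b} Gab = Elem a b , λ x y → ≈-sym (≈-trans (∑∑-Elem _ x y) (selected x y))
    where
    selected : ∀ x y → (if G x y then Elem a b x y else 0#) ≈ Elem a b x y
    selected x y with G x y in Gxy
    ... | true  = ≈-refl
    ... | false = ≈-sym (Elem-off a b x y λ where (refl , refl) → contradiction (trans (sym Gab) Gxy) λ ())

  IndependentOn : Graph n → ∀ {e} → (Fin e → Matrix n) → Set (c ⊔ ℓ)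
  IndependentOn M {e} Bs =
    ∀ coef → (∀ i j → M i j ≡ true → lincombₘ coef Bs i j ≈ 0#) → ∀ t → ¬ ¬ (coef t ≈ 0#)

  nonzero-entry : ∀ {M : Graph n} {e} {Bs : Fin (suc e) → Matrix n} → IndependentOn M Bs →
                  ¬ ¬ (∃₂ λ a b → M a b ≡ true × ¬ (Bs fzero a b ≈ 0#))
  nonzero-entry {n} {M} {e} {Bs} indep none =
    ¬¬-∀Fin (λ a → ¬¬-∀Fin λ b → vanishes a b) λ B₀|M → indep first (combination B₀|M) fzero (0≉1 ∘ ≈-sym)
    where
    first : Fin (suc e) → K
    first fzero    = 1#
    first (fsuc _) = 0#

    vanishes : ∀ a b → ¬ ¬ (M a b ≡ true → Bs fzero a b ≈ 0#)
    vanishes a b with M a b in Mab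
    ... | false = contradiction λ ()
    ... | true  = ¬¬-map const λ B≉0 → none (a , b , Mab , B≉0)

    combination : (∀ a b → M a b ≡ true → Bs fzero a b ≈ 0#) →
                  ∀ i j → M i j ≡ true → lincombₘ first Bs i j ≈ 0#
    combination B₀|M i j Mij = begin
      1# * Bs fzero i j + ∑ e (λ s → 0# * Bs (fsuc s) i j) ≈⟨ +-cong (*-identityˡ _) (∑-zero e λ s → zeroˡ _) ⟩
      Bs fzero i j + 0#                                    ≈⟨ +-identityʳ _ ⟩
      Bs fzero i j                                         ≈⟨ B₀|M i j Mij ⟩
      0#                                                   ∎

  module Elimination {e} (Bs : Fin (suc e) → Matrix n) {a b y} (pivot : Bs fzero a b * y ≈ 1#) where

    factor : Fin e → K
    factor s = - (Bs (fsuc s) a b * y)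

    reduced : Fin e → Matrix n
    reduced s i j = Bs (fsuc s) i j + factor s * Bs fzero i j

    reduced-pivot : ∀ s → reduced s a b ≈ 0#
    reduced-pivot s = begin
      x + - (x * y) * Bs fzero a b ≈⟨ +-congˡ (-‿distribˡ-* (x * y) _) ⟨
      x - x * y * Bs fzero a b     ≈⟨ +-congˡ (-‿cong x*y*pivot≈x) ⟩
      x - x                        ≈⟨ -‿inverseʳ x ⟩
      0#                           ∎
      where
      x = Bs (fsuc s) a b
      x*y*pivot≈x : x * y * Bs fzero a b ≈ x
      x*y*pivot≈x = begin
        x * y * Bs fzero a b   ≈⟨ *-assoc x y _ ⟩
        x * (y * Bs fzero a b) ≈⟨ *-congˡ (≈-trans (*-comm y _) pivot) ⟩
        x * 1#                 ≈⟨ *-identityʳ x ⟩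
        x                      ∎

    lift : (Fin e → K) → Fin (suc e) → K
    lift coef fzero    = ∑ e (λ s → coef s * factor s)
    lift coef (fsuc s) = coef s

    lincomb-reduced : ∀ coef i j → lincombₘ coef reduced i j ≈ lincombₘ (lift coef) Bs i j
    lincomb-reduced coef i j = begin
      ∑ e (λ s → coef s * (Bs (fsuc s) i j + factor s * Bs fzero i j))
        ≈⟨ ∑-cong e (λ s → distribˡ (coef s) _ _) ⟩
      ∑ e (λ s → coef s * Bs (fsuc s) i j + coef s * (factor s * Bs fzero i j))
        ≈⟨ ∑-distrib-+ e _ _ ⟩
      ∑ e (λ s → coef s * Bs (fsuc s) i j) + ∑ e (λ s → coef s * (factor s * Bs fzero i j))
        ≈⟨ +-congˡ (∑-cong e λ s → *-assoc (coef s) _ _) ⟨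
      ∑ e (λ s → coef s * Bs (fsuc s) i j) + ∑ e (λ s → coef s * factor s * Bs fzero i j)
        ≈⟨ +-congˡ (*-distribʳ-∑ e _ _) ⟨
      ∑ e (λ s → coef s * Bs (fsuc s) i j) + lift coef fzero * Bs fzero i j
        ≈⟨ +-comm _ _ ⟩
      lincombₘ (lift coef) Bs i j
        ∎

    reduced-independent : ∀ {M} → IndependentOn M Bs → IndependentOn (deleteArc M a b) reduced
    reduced-independent {M} indep coef vanish s = indep (lift coef) vanish′ (fsuc s)
      where
      reduced-vanishes : ∀ i j → M i j ≡ true → lincombₘ coef reduced i j ≈ 0#
      reduced-vanishes i j Mij with i ≟ a | j ≟ b
      ... | yes refl | yes refl = ∑-zero e λ s → ≈-trans (*-congˡ (reduced-pivot s)) (zeroʳ _)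
      ... | yes _    | no j≢b   = vanish i j (trans (deleteArc-≢ M (j≢b ∘ proj₂)) Mij)
      ... | no i≢a   | _        = vanish i j (trans (deleteArc-≢ M (i≢a ∘ proj₁)) Mij)

      vanish′ : ∀ i j → M i j ≡ true → lincombₘ (lift coef) Bs i j ≈ 0#
      vanish′ i j Mij = ≈-trans (≈-sym (lincomb-reduced coef i j)) (reduced-vanishes i j Mij)

  independentOn⇒≤arcs : ∀ (M : Graph n) {e} {Bs : Fin e → Matrix n} → IndependentOn M Bs → ¬ ¬ (e ≤ arcs M)
  independentOn⇒≤arcs M {zero}  _ = contradiction z≤n
  independentOn⇒≤arcs M {suc e} {Bs} indep = do
    (a , b , Mab , pivot≉0) ← nonzero-entry {M = M} {Bs = Bs} indep
    let open Elimination Bs (proj₂ (inverse _ pivot≉0))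
    e≤ ← independentOn⇒≤arcs (deleteArc M a b) (reduced-independent indep)
    contradiction (subst (suc e ≤_) (sym (arcs-deleteArc M Mab)) (s≤s e≤))

  lincombₘ-vanishes : ∀ {k} coef (Ms : Fin k → Matrix n) {x y} → (∀ t → Ms t x y ≈ 0#) → lincombₘ coef Ms x y ≈ 0#
  lincombₘ-vanishes {k = k} coef Ms Ms≈0 = ∑-zero k λ t → ≈-trans (*-congˡ (Ms≈0 t)) (zeroʳ _)

  unit : Fin n → Vector n
  unit i j = if does (i ≟ j) then 1# else 0#

  unit-diag : ∀ (i : Fin n) → unit i i ≈ 1#
  unit-diag i with i ≟ i
  ... | yes _   = ≈-refl
  ... | no  i≢i = contradiction refl i≢i

  unit-off : ∀ (i j : Fin n) → i ≢ j → unit i j ≈ 0#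
  unit-off i j i≢j with i ≟ j
  ... | yes i≡j = contradiction i≡j i≢j
  ... | no  _   = ≈-refl

  unit-diag≉0 : ∀ (i : Fin n) → ¬ (unit i i ≈ 0#)
  unit-diag≉0 i unit≈0 = 0≉1 (≈-trans (≈-sym unit≈0) (unit-diag i))

  SupportedIn : (Fin n → Bool) → Vector n → Set ℓ
  SupportedIn Q v = ∀ j → Q j ≡ false → v j ≈ 0#

  coordinates : (Fin n → Bool) → Fin n → Vector n
  coordinates Q i j = if Q i then unit i j else 0#

  supported⇒∈coordinates : ∀ {Q} {v : Vector n} → SupportedIn Q v → v ∈Spanᵥ coordinates Q
  supported⇒∈coordinates {n} {Q} {v} v|Q = v , λ j → ≈-sym (≈-trans (∑-δ n _ j (off j)) (diag j))
    where
    off : ∀ j i → i ≢ j → v i * coordinates Q i j ≈ 0#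
    off j i i≢j with Q i
    ... | true  = ≈-trans (*-congˡ (unit-off i j i≢j)) (zeroʳ _)
    ... | false = zeroʳ _
    diag : ∀ j → v j * coordinates Q j j ≈ v j
    diag j with Q j in Qj
    ... | true  = ≈-trans (*-congˡ (unit-diag j)) (*-identityʳ _)
    ... | false = ≈-trans (zeroʳ _) (≈-sym (v|Q j Qj))

  ∈coordinates⇒supported : ∀ {Q} {v : Vector n} → v ∈Spanᵥ coordinates Q → SupportedIn Q v
  ∈coordinates⇒supported {n} {Q} (coef , v≈) j Qj = ≈-trans (v≈ j) (∑-zero n term)
    where
    term : ∀ i → coef i * coordinates Q i j ≈ 0#
    term i with Q i in Qi
    ... | false = zeroʳ _
    ... | true  = ≈-trans (*-congˡ (unit-off i j λ where refl → contradiction (trans (sym Qi) Qj) λ ())) (zeroʳ _)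

  Preserves : (Fin n → Bool) → Matrix n → Set ℓ
  Preserves Q B = ∀ k z → Q k ≡ true → Q z ≡ false → B k z ≈ 0#

  preserves-supported : ∀ {Q} {B : Matrix n} → Preserves Q B → ∀ {u} → SupportedIn Q u → SupportedIn Q (u · B)
  preserves-supported {n} {Q} {B} preserves {u} u|Q z Qz = ∑-zero n term
    where
    term : ∀ k → u k * B k z ≈ 0#
    term k with Q k in Qk
    ... | false = ≈-trans (*-congʳ (u|Q k Qk)) (zeroˡ _)
    ... | true  = ≈-trans (*-congˡ (preserves k z Qk Qz)) (zeroʳ _)

  module CutSubspace (G : Graph n) (Q : Fin n → Bool) where

    src tgt : Fin (arcs (cut G Q)) → Fin n
    src = source (cut G Q)
    tgt = target (cut G Q)

    basis : Fin (arcs (cut G Q)) → Matrix n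
    basis t = Elem (src t) (tgt t)

    basis∈S : ∀ t → basis t ∈S G
    basis∈S t = Elem∈S (cut-⊆ G Q _ _ (arc-∈ (cut G Q) t))

    basis-independent : LinIndepₘ basis
    basis-independent coef combination≈0 t = ≈-trans (≈-sym evaluate) (combination≈0 (src t) (tgt t))
      where
      evaluate : lincombₘ coef basis (src t) (tgt t) ≈ coef t
      evaluate = ≈-trans (∑-δ _ _ t λ t′ t′≢t → ≈-trans (*-congˡ (other t′ t′≢t)) (zeroʳ _))
                         (≈-trans (*-congˡ (Elem-diag (src t) (tgt t))) (*-identityʳ _))
        where
        other : ∀ t′ → t′ ≢ t → basis t′ (src t) (tgt t) ≈ 0#
        other t′ t′≢t = Elem-off (src t′) (tgt t′) (src t) (tgt t) λ (s≡ , t≡) →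
          t′≢t (arc-injective (cut G Q) (sym s≡) (sym t≡))

    basis-preserves : ∀ t → Preserves Q (basis t)
    basis-preserves t k z Qk Qz = Elem-off (src t) (tgt t) k z λ where
      (refl , refl) → contradiction (trans (sym (arc-∈ (cut G Q) t)) (cut-closed G Q k z Qk Qz)) λ ()

    reducible : Proper Q → Reducible basis
    reducible ((i , Qi) , (j , Qj)) =
      n , coordinates Q , (unit i , unit-i∈U , λ unit≈0 → unit-diag≉0 i (unit≈0 i)) , (unit j , unit-j∉U) , invariant
      where
      unit-i∈U : unit i ∈Spanᵥ coordinates Q
      unit-i∈U = supported⇒∈coordinates {Q = Q} λ k Qk → unit-off i k λ where
        refl → contradiction (trans (sym Qi) Qk) λ ()

      unit-j∉U : ¬ (unit j ∈Spanᵥ coordinates Q)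
      unit-j∉U unit∈U = unit-diag≉0 j (∈coordinates⇒supported {Q = Q} unit∈U j Qj)

      invariant : ∀ B → B ∈Spanₘ basis → ∀ u → u ∈Spanᵥ coordinates Q → (u · B) ∈Spanᵥ coordinates Q
      invariant B (coef , B≈) u u∈U =
        supported⇒∈coordinates {Q = Q} (preserves-supported {Q = Q} B-preserves (∈coordinates⇒supported {Q = Q} u∈U))
        where
        B-preserves : Preserves Q B
        B-preserves k z Qk Qz = ≈-trans (B≈ k z) (lincombₘ-vanishes coef basis {k} {z} λ t → basis-preserves t k z Qk Qz)

  cut-reducible : ∀ {G : Graph n} {Q} → Proper Q → HasReducibleSubspaceOfDim G (arcs (cut G Q))
  cut-reducible {G = G} {Q} proper = basis , basis∈S , basis-independent , reducible proper
    where open CutSubspace G Q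

  reducible⇒cut : ∀ {G : Graph n} {e} → HasReducibleSubspaceOfDim G e →
                  ¬ ¬ (∃ λ Q → Proper Q × e ≤ arcs (cut G Q))
  reducible⇒cut {n} {G} {e} (Bs , Bs∈S , Bs-independent , m , us , (v , v∈U , v≉0) , (v′ , v′∉U) , invariant) = do
    (P , basis , complete) ← echelon-basis us
    i ← pivot-exists us basis complete v∈U v≉0
    j ← non-pivot-exists us basis complete v′∉U
    e≤ ← independentOn⇒≤arcs (cut G P) (independent basis complete)
    contradiction (P , (i , j) , e≤)
    where
    independent : ∀ {P} → EchelonBasis us P → Complete us P → IndependentOn (cut G P) Bs
    independent {P} basis complete coef vanish t =
      ¬¬-map (λ B≈0 → Bs-independent coef B≈0 t)
             (invariant-leaving⇒zero us basis complete (invariant B (coef , λ _ _ → ≈-refl)) off-leaving)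
      where
      B : Matrix n
      B = lincombₘ coef Bs
      off-leaving : ∀ k z → P k ≡ false ⊎ P z ≡ true → B k z ≈ 0#
      off-leaving k z kept with G k z in Gkz
      ... | false = lincombₘ-vanishes coef Bs λ t → ∈S-support (Bs∈S t) Gkz
      ... | true  = vanish k z (cut-keeps G P Gkz kept)

  isMaxCut⇔isMaxReducibleDim : ∀ (G : Graph n) d → IsMaxCut G d ⇔ IsMaxReducibleDim G d
  isMaxCut⇔isMaxReducibleDim G d = mk⇔ to from
    where
    to : IsMaxCut G d → IsMaxReducibleDim G d
    to ((Q , proper , arcs≡d) , max) =
      subst (HasReducibleSubspaceOfDim G) arcs≡d (cut-reducible proper) ,
      λ e reducible → decidable-stable (e ≤? d)
        (¬¬-map (λ (Q , proper , e≤) → ≤-trans e≤ (max Q proper)) (reducible⇒cut reducible))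

    from : IsMaxReducibleDim G d → IsMaxCut G d
    from (reducible , max) = attained (decidable-stable (large-cut? G d) (reducible⇒cut reducible)) , cut-max
      where
      cut-max : ∀ Q → Proper Q → arcs (cut G Q) ≤ d
      cut-max Q proper = max _ (cut-reducible proper)
      attained : (∃ λ Q → Proper Q × d ≤ arcs (cut G Q)) → ∃ λ Q → Proper Q × arcs (cut G Q) ≡ d
      attained (Q , proper , d≤) = Q , proper , ≤-antisym (cut-max Q proper) d≤

theorem1p13 : ∀ {c ℓ : Level} (𝔽 : Field c ℓ) (n : ℕ) (G : Graph n) (d : ℕ) → IsMaxNonSCArcs G d ⇔ LinAlg.IsMaxReducibleDim 𝔽 G d
theorem1p13 𝔽 n G d = isMaxCut⇔isMaxReducibleDim 𝔽 G d ⇔-∘ isMaxNonSCArcs⇔isMaxCut G d
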